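{- If there is an embeddable graph $G$ on $n$ vertices having a vertex with fixed color $1$, then there is a Kochen-Specker graph on $2n$ vertices.
   Context: All graphs are finite simple graphs. Identify antipodal points of the unit sphere in $\mathbb{R}^3$, i.e. work in the real projective plane (points are lines through the origin in $\mathbb{R}^3$); two such points are orthogonal if the corresponding lines are orthogonal. For a finite subset $S$ of the projective plane, its orthogonality graph $G(S)$ has vertex set $S$, with two vertices adjacent iff the corresponding points are orthogonal. A graph $G$ is embeddable if it is (isomorphic to) a subgraph, not necessarily induced, of $G(S)$ for some finite subset $S$ of the projective plane. A 010-coloring of a graph is a map from its vertices to $\{0,1\}$ such that (1) in every triangle exactly one vertex is colored $1$, and (2) no two adjacent vertices are both colored $1$; a graph is 010-colorable if it has a 010-coloring. A Kochen-Specker graph is an embeddable graph that is not 010-colorable. A vertex $v$ of $G$ has fixed color $c\in\{0,1\}$ in $G$ if $G$ is 010-colorable and every 010-coloring of $G$ assigns color $c$ to $v$. -}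

module Defs where

open import Data.Nat using (ℕ)
open import Data.Fin using (Fin)
open import Data.Bool using (Bool; true; false)
open import Data.Product using (Σ; ∃; _×_; _,_)
open import Data.Sum using (_⊎_)
open import Relation.Binary.PropositionalEquality using (_≡_; _≢_)
open import Relation.Nullary using (¬_)

-- The real numbers, axiomatised as a complete ordered field.
-- (All complete ordered fields are isomorphic to ℝ, so quantifying over
-- every such structure is the same as speaking about ℝ.)

record RealNumbers : Set₁ where
  infixl 6 _+_
  infixl 7 _*_
  infix 4 _≤_
  field
    Carrier : Set
    0# 1#   : Carrier
    _+_ _*_ : Carrier → Carrier → Carrier
    -_      : Carrier → Carrier
    _≤_     : Carrier → Carrier → Set
    +-assoc     : ∀ x y z → (x + y) + z ≡ x + (y + z)
    +-comm      : ∀ x y → x + y ≡ y + x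
    +-identityˡ : ∀ x → 0# + x ≡ x
    +-inverseˡ  : ∀ x → (- x) + x ≡ 0#
    *-assoc     : ∀ x y z → (x * y) * z ≡ x * (y * z)
    *-comm      : ∀ x y → x * y ≡ y * x
    *-identityˡ : ∀ x → 1# * x ≡ x
    distribˡ    : ∀ x y z → x * (y + z) ≡ (x * y) + (x * z)
    0≢1         : 0# ≢ 1#
    *-inverse   : ∀ x → x ≢ 0# → ∃ λ y → x * y ≡ 1#
    ≤-refl      : ∀ x → x ≤ x
    ≤-trans     : ∀ {x y z} → x ≤ y → y ≤ z → x ≤ z
    ≤-antisym   : ∀ {x y} → x ≤ y → y ≤ x → x ≡ y
    ≤-total     : ∀ x y → x ≤ y ⊎ y ≤ x
    +-mono-≤    : ∀ {x y} z → x ≤ y → x + z ≤ y + z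
    *-nonneg    : ∀ {x y} → 0# ≤ x → 0# ≤ y → 0# ≤ x * y
    sup         : (P : Carrier → Set) → ∃ P →
                  (∃ λ b → ∀ x → P x → x ≤ b) →
                  ∃ λ s → (∀ x → P x → x ≤ s) ×
                          (∀ b → (∀ x → P x → x ≤ b) → s ≤ b)

record Graph (n : ℕ) : Set where
  field
    adj       : Fin n → Fin n → Bool
    adj-sym   : ∀ i j → adj i j ≡ adj j i
    adj-irrefl : ∀ i → adj i i ≡ false
open Graph public

module _ (ℝ : RealNumbers) where
  open RealNumbers ℝ

  Vec3 : Set
  Vec3 = Carrier × Carrier × Carrier

  _·_ : Vec3 → Vec3 → Carrier
  (a , b , c) · (x , y , z) = a * x + b * y + c * z

  scale : Carrier → Vec3 → Vec3
  scale t (x , y , z) = (t * x , t * y , t * z)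

  NonZero3 : Vec3 → Set
  NonZero3 v = v ≢ (0# , 0# , 0#)

  -- two nonzero vectors represent the same projective point
  SameLine : Vec3 → Vec3 → Set
  SameLine u v = ∃ λ t → u ≡ scale t v

  -- G is embeddable: it is isomorphic to a (not necessarily induced)
  -- subgraph of G(S) for a finite set S of projective points; i.e. there
  -- is an injective assignment of projective points (nonzero vectors up
  -- to scaling) to vertices sending adjacent vertices to orthogonal points.
  Embeddable : ∀ {n} → Graph n → Set
  Embeddable {n} G =
    Σ (Fin n → Vec3) λ f →
      (∀ i → NonZero3 (f i)) ×
      (∀ i j → SameLine (f i) (f j) → i ≡ j) ×
      (∀ i j → adj G i j ≡ true → f i · f j ≡ 0#)

ExactlyOne : Bool → Bool → Bool → Set
ExactlyOne true  false false = Data.Unit.⊤ where import Data.Unit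
ExactlyOne false true  false = Data.Unit.⊤ where import Data.Unit
ExactlyOne false false true  = Data.Unit.⊤ where import Data.Unit
ExactlyOne _     _     _     = Data.Empty.⊥ where import Data.Empty

Is010Coloring : ∀ {n} → Graph n → (Fin n → Bool) → Set
Is010Coloring G c =
  (∀ i j k → adj G i j ≡ true → adj G j k ≡ true → adj G i k ≡ true →
     ExactlyOne (c i) (c j) (c k)) ×
  (∀ i j → adj G i j ≡ true → ¬ (c i ≡ true × c j ≡ true))

Colorable010 : ∀ {n} → Graph n → Set
Colorable010 {n} G = ∃ λ (c : Fin n → Bool) → Is010Coloring G c

KochenSpecker : RealNumbers → ∀ {n} → Graph n → Set
KochenSpecker ℝ G = Embeddable ℝ G × ¬ Colorable010 G

HasFixedColor : ∀ {n} → Graph n → Fin n → Bool → Set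
HasFixedColor {n} G v b =
  Colorable010 G × (∀ (c : Fin n → Bool) → Is010Coloring G c → c v ≡ b)

-- Let f embed G in the projective plane and let v have fixed colour 1.
-- The twin of G at v consists of two disjoint copies of G whose two copies
-- of v are joined by an edge; it has 2n vertices.  It is not
-- 010-colourable: a colouring restricts to each copy, so both copies of v
-- get colour 1, yet they are adjacent.  It is embeddable: place the first
-- copy by f and the second by R ∘ f, where R is a similarity of ℝ³ (it
-- scales all inner products by one nonzero factor) with f v ⊥ R (f v) and
-- with no R (f i) parallel to any f j.  Such an R is a half-turn taking
-- f v to a multiple of some b₀ ⊥ f v, composed with a rotation about f v;
-- the direction of b₀ and the rotation are chosen among finitely many
-- quaternion rotations about f v, because two distinct ones never produce
-- the same forbidden parallelism.
module Submission where

open import Defs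
open import Data.Nat as ℕ using (ℕ; zero; suc)
import Data.Nat.Properties as ℕP
open import Data.Fin as F using (Fin; zero; suc)
import Data.Fin.Properties as FP
open import Data.Integer as ℤ using (ℤ; -[1+_]) renaming (+_ to +[_])
import Data.Integer.Properties as ℤP
open import Data.Product using (_,_; proj₁; proj₂; ∃; _×_; Σ)
open import Data.Sum using (_⊎_; inj₁; inj₂)
open import Data.Empty using (⊥; ⊥-elim)
open import Data.Maybe using (Maybe; just; nothing)
open import Relation.Nullary using (¬_; yes; no; does)
open import Data.Bool using (Bool; true; false; _∧_)
import Data.Bool.Properties as BoolP
open import Relation.Binary.PropositionalEquality
open import Algebra.Bundles using (CommutativeRing)
open import Algebra.Structures using (IsCommutativeRing)
import Algebra.Consequences.Propositional as Consequences
import Algebra.Properties.Ring as RingProperties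
import Algebra.Properties.CommutativeSemigroup as CommutativeSemigroupProperties
open import Algebra.Solver.Ring.AlmostCommutativeRing
  using (AlmostCommutativeRing; fromCommutativeRing; _-Raw-AlmostCommutative⟶_)
import Algebra.Solver.Ring as RingSolver

-- The field operations of a model of the reals form a commutative ring
-- (with propositional equality), and the integers map homomorphically
-- into it.  This is what makes the integer-coefficient ring solver
-- available for all polynomial identities below.
module FieldAlgebra (ℝ : RealNumbers) where
  open RealNumbers ℝ public

  isCommutativeRing : IsCommutativeRing _≡_ _+_ _*_ -_ 0# 1#
  isCommutativeRing = record
    { isRing = record
      { +-isAbelianGroup = record
        { isGroup = record
          { isMonoid = record
            { isSemigroup = record
              { isMagma = record { isEquivalence = isEquivalence ; ∙-cong = cong₂ _+_ }
              ; assoc = +-assoc }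
            ; identity = comm∧idˡ⇒id +-comm +-identityˡ }
          ; inverse = comm∧invˡ⇒inv +-comm +-inverseˡ
          ; ⁻¹-cong = cong -_ }
        ; comm = +-comm }
      ; *-cong = cong₂ _*_
      ; *-assoc = *-assoc
      ; *-identity = comm∧idˡ⇒id *-comm *-identityˡ
      ; distrib = distribˡ , comm∧distrˡ⇒distrʳ *-comm distribˡ }
    ; *-comm = *-comm }
    where open Consequences

  commutativeRing : CommutativeRing _ _
  commutativeRing = record { isCommutativeRing = isCommutativeRing }

  open RingProperties (CommutativeRing.ring commutativeRing) public
    using (-‿involutive; -‿distribˡ-*; -0#≈0#; -‿+-comm)
  open CommutativeRing commutativeRing public
    using (+-identityʳ; -‿inverseʳ; *-identityʳ; zeroˡ; zeroʳ; distribʳ)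
  open CommutativeSemigroupProperties (CommutativeRing.+-commutativeSemigroup commutativeRing)
    using (interchange; x∙yz≈y∙xz)

  fromℕ : ℕ → Carrier
  fromℕ zero          = 0#
  fromℕ (suc zero)    = 1#
  fromℕ (suc (suc n)) = 1# + fromℕ (suc n)

  fromℤ : ℤ → Carrier
  fromℤ +[ n ]    = fromℕ n
  fromℤ -[1+ n ] = - fromℕ (suc n)

  fromℕ-suc : ∀ n → fromℕ (suc n) ≡ 1# + fromℕ n
  fromℕ-suc zero    = sym (+-identityʳ 1#)
  fromℕ-suc (suc n) = refl

  fromℕ-+ : ∀ m n → fromℕ (m ℕ.+ n) ≡ fromℕ m + fromℕ n
  fromℕ-+ zero    n = sym (+-identityˡ _)
  fromℕ-+ (suc m) n = begin
    fromℕ (suc (m ℕ.+ n))      ≡⟨ fromℕ-suc (m ℕ.+ n) ⟩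
    1# + fromℕ (m ℕ.+ n)       ≡⟨ cong (1# +_) (fromℕ-+ m n) ⟩
    1# + (fromℕ m + fromℕ n)   ≡⟨ sym (+-assoc _ _ _) ⟩
    (1# + fromℕ m) + fromℕ n   ≡⟨ cong (_+ fromℕ n) (sym (fromℕ-suc m)) ⟩
    fromℕ (suc m) + fromℕ n    ∎
    where open ≡-Reasoning

  -- fromℤ is a ring homomorphism; on sums of opposite sign this reduces to
  -- natural-number subtraction _⊖_, computed by peeling off 1 from both sides
  shift-difference : ∀ m n → (1# + m) + - (1# + n) ≡ m + - n
  shift-difference m n = begin
    (1# + m) + - (1# + n)      ≡⟨ cong ((1# + m) +_) (sym (-‿+-comm 1# n)) ⟩
    (1# + m) + (- 1# + - n)    ≡⟨ interchange 1# m (- 1#) (- n) ⟩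
    (1# + - 1#) + (m + - n)    ≡⟨ cong (_+ (m + - n)) (-‿inverseʳ 1#) ⟩
    0# + (m + - n)             ≡⟨ +-identityˡ _ ⟩
    m + - n                    ∎
    where open ≡-Reasoning

  fromℤ-⊖ : ∀ m n → fromℤ (m ℤ.⊖ n) ≡ fromℕ m + - fromℕ n
  fromℤ-⊖ m       zero    = trans (cong fromℤ (ℤP.⊖-≥ {m} ℕ.z≤n))
                                  (sym (trans (cong (fromℕ m +_) -0#≈0#) (+-identityʳ _)))
  fromℤ-⊖ zero    (suc n) = sym (+-identityˡ _)
  fromℤ-⊖ (suc m) (suc n) = begin
    fromℤ (suc m ℤ.⊖ suc n)    ≡⟨ cong fromℤ (ℤP.[1+m]⊖[1+n]≡m⊖n m n) ⟩
    fromℤ (m ℤ.⊖ n)            ≡⟨ fromℤ-⊖ m n ⟩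
    fromℕ m + - fromℕ n        ≡⟨ sym (shift-difference (fromℕ m) (fromℕ n)) ⟩
    (1# + fromℕ m) + - (1# + fromℕ n)
                               ≡⟨ cong₂ (λ a b → a + - b) (sym (fromℕ-suc m)) (sym (fromℕ-suc n)) ⟩
    fromℕ (suc m) + - fromℕ (suc n) ∎
    where open ≡-Reasoning

  fromℤ-+ : ∀ i j → fromℤ (i ℤ.+ j) ≡ fromℤ i + fromℤ j
  fromℤ-+ +[ m ]    +[ n ]    = fromℕ-+ m n
  fromℤ-+ +[ m ]    -[1+ n ] = fromℤ-⊖ m (suc n)
  fromℤ-+ -[1+ m ] +[ n ]    = trans (fromℤ-⊖ n (suc m)) (+-comm _ _)
  fromℤ-+ -[1+ m ] -[1+ n ] = begin
    - (1# + fromℕ (suc (m ℕ.+ n)))         ≡⟨ cong (λ z → - (1# + z)) (fromℕ-suc (m ℕ.+ n)) ⟩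
    - (1# + (1# + fromℕ (m ℕ.+ n)))        ≡⟨ cong (λ z → - (1# + (1# + z))) (fromℕ-+ m n) ⟩
    - (1# + (1# + (fromℕ m + fromℕ n)))    ≡⟨ cong -_ (cong (1# +_) (x∙yz≈y∙xz 1# (fromℕ m) (fromℕ n))) ⟩
    - (1# + (fromℕ m + (1# + fromℕ n)))    ≡⟨ cong -_ (sym (+-assoc _ _ _)) ⟩
    - ((1# + fromℕ m) + (1# + fromℕ n))    ≡⟨ cong₂ (λ a b → - (a + b)) (sym (fromℕ-suc m)) (sym (fromℕ-suc n)) ⟩
    - (fromℕ (suc m) + fromℕ (suc n))      ≡⟨ sym (-‿+-comm _ _) ⟩
    - fromℕ (suc m) + - fromℕ (suc n)      ∎
    where open ≡-Reasoning

  fromℤ-neg : ∀ i → fromℤ (ℤ.- i) ≡ - fromℤ i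
  fromℤ-neg +[ zero ]  = sym -0#≈0#
  fromℤ-neg (+[ suc n ]) = refl
  fromℤ-neg -[1+ n ]  = sym (-‿involutive _)

  fromℤ-*⁺ : ∀ n j → fromℤ (+[ n ] ℤ.* j) ≡ fromℕ n * fromℤ j
  fromℤ-*⁺ zero    j = trans (cong fromℤ (ℤP.*-zeroˡ j)) (sym (zeroˡ _))
  fromℤ-*⁺ (suc n) j = begin
    fromℤ (+[ suc n ] ℤ.* j)          ≡⟨ cong fromℤ (ℤP.suc-* +[ n ] j) ⟩
    fromℤ (j ℤ.+ +[ n ] ℤ.* j)        ≡⟨ fromℤ-+ j (+[ n ] ℤ.* j) ⟩
    fromℤ j + fromℤ (+[ n ] ℤ.* j)    ≡⟨ cong₂ _+_ (sym (*-identityˡ _)) (fromℤ-*⁺ n j) ⟩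
    1# * fromℤ j + fromℕ n * fromℤ j  ≡⟨ sym (distribʳ _ _ _) ⟩
    (1# + fromℕ n) * fromℤ j          ≡⟨ cong (_* fromℤ j) (sym (fromℕ-suc n)) ⟩
    fromℕ (suc n) * fromℤ j           ∎
    where open ≡-Reasoning

  fromℤ-* : ∀ i j → fromℤ (i ℤ.* j) ≡ fromℤ i * fromℤ j
  fromℤ-* +[ n ]    j = fromℤ-*⁺ n j
  fromℤ-* -[1+ n ] j = begin
    fromℤ (-[1+ n ] ℤ.* j)             ≡⟨ cong fromℤ (sym (ℤP.neg-distribˡ-* +[ suc n ] j)) ⟩
    fromℤ (ℤ.- (+[ suc n ] ℤ.* j))     ≡⟨ fromℤ-neg (+[ suc n ] ℤ.* j) ⟩
    - fromℤ (+[ suc n ] ℤ.* j)         ≡⟨ cong -_ (fromℤ-*⁺ (suc n) j) ⟩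
    - (fromℕ (suc n) * fromℤ j)        ≡⟨ -‿distribˡ-* _ _ ⟩
    - fromℕ (suc n) * fromℤ j          ∎
    where open ≡-Reasoning

  almostCommutativeRing : AlmostCommutativeRing _ _
  almostCommutativeRing = fromCommutativeRing commutativeRing

  fromℤ-homomorphism : ℤ.+-*-rawRing -Raw-AlmostCommutative⟶ almostCommutativeRing
  fromℤ-homomorphism = record
    { ⟦_⟧ = fromℤ ; +-homo = fromℤ-+ ; *-homo = fromℤ-* ; -‿homo = fromℤ-neg
    ; 0-homo = refl ; 1-homo = refl }

  -- equal integer coefficients have equal images; this is all the
  -- solver needs to know about coefficient equality
  coefficient-equality : ∀ i j → Maybe (fromℤ i ≡ fromℤ j)
  coefficient-equality i j with i ℤ.≟ j
  ... | yes refl = just refl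
  ... | no _     = nothing

  open RingSolver ℤ.+-*-rawRing almostCommutativeRing fromℤ-homomorphism coefficient-equality
    public using (solve; _:=_; con; _:+_; _:*_; :-_; _:-_; Polynomial)

-- Elementary facts about the ordered field, including the two places
-- where completeness is needed: an element whose square vanishes is zero,
-- and nonnegative elements have square roots.
module OrderedField (ℝ : RealNumbers) where
  open FieldAlgebra ℝ public

  infixl 6 _-_
  _-_ : Carrier → Carrier → Carrier
  x - y = x + - y

  two : Carrier
  two = fromℕ 2

  ≤-cong : ∀ {a b c d} → a ≡ c → b ≡ d → a ≤ b → c ≤ d
  ≤-cong refl refl a≤b = a≤b

  ≤⇒0≤- : ∀ {x y} → x ≤ y → 0# ≤ y - x
  ≤⇒0≤- {x} {y} x≤y = ≤-cong (-‿inverseʳ x) refl (+-mono-≤ (- x) x≤y)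

  0≤-⇒≤ : ∀ {x y} → 0# ≤ y - x → x ≤ y
  0≤-⇒≤ {x} {y} 0≤y-x = ≤-cong (+-identityˡ x) (cancel y x) (+-mono-≤ x 0≤y-x)
    where
    cancel : ∀ y x → y - x + x ≡ y
    cancel = solve 2 (λ y x → y :- x :+ x := y) refl

  +-mono : ∀ {a b c d} → a ≤ b → c ≤ d → a + c ≤ b + d
  +-mono {a} {b} {c} {d} a≤b c≤d =
    ≤-trans (+-mono-≤ c a≤b) (≤-cong (+-comm c b) (+-comm d b) (+-mono-≤ b c≤d))

  0≤+ : ∀ {a b} → 0# ≤ a → 0# ≤ b → 0# ≤ a + b
  0≤+ 0≤a 0≤b = ≤-cong (+-identityˡ 0#) refl (+-mono 0≤a 0≤b)

  ≤0⇒0≤- : ∀ {x} → x ≤ 0# → 0# ≤ - x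
  ≤0⇒0≤- {x} x≤0 = ≤-cong refl (+-identityˡ (- x)) (≤⇒0≤- x≤0)

  0≤⇒-≤0 : ∀ {x} → 0# ≤ x → - x ≤ 0#
  0≤⇒-≤0 {x} 0≤x = 0≤-⇒≤ (≤-cong refl (sym (0--- x)) 0≤x)
    where
    0--- : ∀ x → 0# - - x ≡ x
    0--- = solve 1 (λ x → con +[ 0 ] :- :- x := x) refl

  ≤⇒-≤0 : ∀ {x y} → x ≤ y → x - y ≤ 0#
  ≤⇒-≤0 {x} {y} x≤y = ≤-cong (negate-difference y x) refl (0≤⇒-≤0 (≤⇒0≤- x≤y))
    where
    negate-difference : ∀ y x → - (y - x) ≡ x - y
    negate-difference = solve 2 (λ y x → :- (y :- x) := x :- y) refl

  -≤0⇒≤ : ∀ {x y} → x - y ≤ 0# → x ≤ y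
  -≤0⇒≤ {x} {y} x-y≤0 = 0≤-⇒≤ (≤-cong refl (negate-difference x y) (≤0⇒0≤- x-y≤0))
    where
    negate-difference : ∀ x y → - (x - y) ≡ y - x
    negate-difference = solve 2 (λ x y → :- (x :- y) := y :- x) refl

  0≤*ˡ : ∀ {c a b} → 0# ≤ c → a ≤ b → c * a ≤ c * b
  0≤*ˡ {c} {a} {b} 0≤c a≤b = 0≤-⇒≤ (≤-cong refl (factor c a b) (*-nonneg 0≤c (≤⇒0≤- a≤b)))
    where
    factor : ∀ c a b → c * (b - a) ≡ c * b - c * a
    factor = solve 3 (λ c a b → c :* (b :- a) := c :* b :- c :* a) refl

  0≤square : ∀ x → 0# ≤ x * x
  0≤square x with ≤-total 0# x
  ... | inj₁ 0≤x = *-nonneg 0≤x 0≤x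
  ... | inj₂ x≤0 = ≤-cong refl (neg-square x) (*-nonneg (≤0⇒0≤- x≤0) (≤0⇒0≤- x≤0))
    where
    neg-square : ∀ x → - x * - x ≡ x * x
    neg-square = solve 1 (λ x → :- x :* :- x := x :* x) refl

  0≤1 : 0# ≤ 1#
  0≤1 = ≤-cong refl (*-identityˡ 1#) (0≤square 1#)

  1≢0 : 1# ≢ 0#
  1≢0 1≡0 = 0≢1 (sym 1≡0)

  1≰0 : ¬ (1# ≤ 0#)
  1≰0 1≤0 = 1≢0 (≤-antisym 1≤0 0≤1)

  0≤fromℕ : ∀ n → 0# ≤ fromℕ n
  0≤fromℕ zero    = ≤-refl 0#
  0≤fromℕ (suc n) = ≤-cong refl (sym (fromℕ-suc n)) (0≤+ 0≤1 (0≤fromℕ n))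

  nonneg-sum≡0 : ∀ {a b} → 0# ≤ a → 0# ≤ b → a + b ≡ 0# → a ≡ 0# × b ≡ 0#
  nonneg-sum≡0 {a} {b} 0≤a 0≤b a+b≡0 = ≤-antisym (bound 0≤b a+b≡0) 0≤a , ≤-antisym (bound 0≤a (trans (+-comm b a) a+b≡0)) 0≤b
    where
    bound : ∀ {p q} → 0# ≤ q → p + q ≡ 0# → p ≤ 0#
    bound {p} {q} 0≤q p+q≡0 = ≤-cong (+-identityʳ p) p+q≡0 (+-mono (≤-refl p) 0≤q)

  positive+nonneg≢0 : ∀ {a b} → 0# ≤ a → a ≢ 0# → 0# ≤ b → a + b ≢ 0#
  positive+nonneg≢0 0≤a a≢0 0≤b a+b≡0 = a≢0 (proj₁ (nonneg-sum≡0 0≤a 0≤b a+b≡0))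

  0≤two : 0# ≤ two
  0≤two = 0≤fromℕ 2

  two≢0 : two ≢ 0#
  two≢0 = positive+nonneg≢0 0≤1 1≢0 0≤1

  fromℕ-injective : ∀ {m n} → fromℕ m ≡ fromℕ n → m ≡ n
  fromℕ-injective {zero}  {zero}  _ = refl
  fromℕ-injective {zero}  {suc n} e = ⊥-elim (positive+nonneg≢0 0≤1 1≢0 (0≤fromℕ n) (sym (trans e (fromℕ-suc n))))
  fromℕ-injective {suc m} {zero}  e = ⊥-elim (positive+nonneg≢0 0≤1 1≢0 (0≤fromℕ m) (trans (sym (fromℕ-suc m)) e))
  fromℕ-injective {suc m} {suc n} e = cong suc (fromℕ-injective (cancel (trans (sym (fromℕ-suc m)) (trans e (fromℕ-suc n)))))
    where
    cancel : ∀ {x y} → 1# + x ≡ 1# + y → x ≡ y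
    cancel {x} {y} e = trans (sym (drop x)) (trans (cong (- 1# +_) e) (drop y))
      where
      drop : ∀ z → - 1# + (1# + z) ≡ z
      drop = solve 1 (λ z → :- con +[ 1 ] :+ (con +[ 1 ] :+ z) := z) refl

  _⁻¹⟨_⟩ : (x : Carrier) → x ≢ 0# → Carrier
  x ⁻¹⟨ x≢0 ⟩ = proj₁ (*-inverse x x≢0)

  *-inverseʳ : ∀ x (x≢0 : x ≢ 0#) → x * x ⁻¹⟨ x≢0 ⟩ ≡ 1#
  *-inverseʳ x x≢0 = proj₂ (*-inverse x x≢0)

  *-cancelˡ-0 : ∀ {x y} → x ≢ 0# → x * y ≡ 0# → y ≡ 0#
  *-cancelˡ-0 {x} {y} x≢0 xy≡0 = begin
    y                 ≡⟨ sym (*-identityˡ y) ⟩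
    1# * y            ≡⟨ cong (_* y) (sym (*-inverseʳ x x≢0)) ⟩
    (x * x⁻¹) * y     ≡⟨ solve 3 (λ x i y → (x :* i) :* y := i :* (x :* y)) refl x x⁻¹ y ⟩
    x⁻¹ * (x * y)     ≡⟨ cong (x⁻¹ *_) xy≡0 ⟩
    x⁻¹ * 0#          ≡⟨ zeroʳ x⁻¹ ⟩
    0#                ∎
    where
    open ≡-Reasoning
    x⁻¹ : Carrier
    x⁻¹ = x ⁻¹⟨ x≢0 ⟩

  *-vanishes : ∀ t {x} → x ≡ 0# → t * x ≡ 0#
  *-vanishes t x≡0 = trans (cong (t *_) x≡0) (zeroʳ t)

  *-≢0 : ∀ {x y} → x ≢ 0# → y ≢ 0# → x * y ≢ 0#
  *-≢0 x≢0 y≢0 xy≡0 = y≢0 (*-cancelˡ-0 x≢0 xy≡0)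

  ⁻¹-≢0 : ∀ {x} (x≢0 : x ≢ 0#) → x ⁻¹⟨ x≢0 ⟩ ≢ 0#
  ⁻¹-≢0 {x} x≢0 x⁻¹≡0 = 0≢1 (trans (sym (zeroʳ x)) (trans (cong (x *_) (sym x⁻¹≡0)) (*-inverseʳ x x≢0)))

  ⁻¹-nonneg : ∀ {x} (x≢0 : x ≢ 0#) → 0# ≤ x → 0# ≤ x ⁻¹⟨ x≢0 ⟩
  ⁻¹-nonneg {x} x≢0 0≤x with ≤-total 0# (x ⁻¹⟨ x≢0 ⟩)
  ... | inj₁ 0≤x⁻¹ = 0≤x⁻¹
  ... | inj₂ x⁻¹≤0 = ⊥-elim (1≰0 (≤-cong (*-inverseʳ x x≢0) (zeroʳ x) (0≤*ˡ 0≤x x⁻¹≤0)))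

  module Supremum (P : Carrier → Set) (inhabited : ∃ P) (bounded : ∃ λ b → ∀ x → P x → x ≤ b) where
    supremum : Carrier
    supremum = proj₁ (sup P inhabited bounded)

    upper : ∀ x → P x → x ≤ supremum
    upper = proj₁ (proj₂ (sup P inhabited bounded))

    least : ∀ b → (∀ x → P x → x ≤ b) → supremum ≤ b
    least = proj₂ (proj₂ (sup P inhabited bounded))

  -- An ordered field with suprema is Archimedean, so it has no nonzero
  -- nilpotents: if 0 ≤ u and u² = 0, the multiples k·u are bounded by 1,
  -- and their supremum t satisfies t ≤ t − u.
  nilpotent⇒≤0 : ∀ {u} → 0# ≤ u → u * u ≡ 0# → u ≤ 0#
  nilpotent⇒≤0 {u} 0≤u u²≡0 = ≤-cong (negate-back u) refl (0≤⇒-≤0 (≤-cong refl (t-u-t t u) (≤⇒0≤- t≤t-u)))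
    where
    Multiple : Carrier → Set
    Multiple z = z ≤ 0# ⊎ Σ ℕ λ k → z ≡ fromℕ k * u

    ku≤1 : ∀ k → fromℕ k * u ≤ 1#
    ku≤1 k with ≤-total (fromℕ k * u) 1#
    ... | inj₁ ku≤1 = ku≤1
    ... | inj₂ 1≤ku = ⊥-elim (1≰0 (≤-trans 1≤ku (≤-cong refl (square-of-multiple k) ku≤ku²)))
      where
      ku≤ku² : fromℕ k * u ≤ (fromℕ k * u) * (fromℕ k * u)
      ku≤ku² = ≤-cong (*-identityʳ _) refl (0≤*ˡ (≤-trans 0≤1 1≤ku) 1≤ku)
      square-of-multiple : ∀ k → (fromℕ k * u) * (fromℕ k * u) ≡ 0#
      square-of-multiple k = begin
        (fromℕ k * u) * (fromℕ k * u)  ≡⟨ solve 2 (λ a u → (a :* u) :* (a :* u) := (a :* a) :* (u :* u)) refl (fromℕ k) u ⟩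
        (fromℕ k * fromℕ k) * (u * u)  ≡⟨ cong (fromℕ k * fromℕ k *_) u²≡0 ⟩
        (fromℕ k * fromℕ k) * 0#       ≡⟨ zeroʳ _ ⟩
        0#                             ∎
        where open ≡-Reasoning

    bounded : ∀ z → Multiple z → z ≤ 1#
    bounded z (inj₁ z≤0)         = ≤-trans z≤0 0≤1
    bounded z (inj₂ (k , refl)) = ku≤1 k

    open Supremum Multiple (0# , inj₁ (≤-refl 0#)) (1# , bounded) renaming (supremum to t)

    u≤t : u ≤ t
    u≤t = upper u (inj₂ (1 , sym (*-identityˡ u)))

    t-u-bound : ∀ z → Multiple z → z ≤ t - u
    t-u-bound z (inj₁ z≤0)         = ≤-trans z≤0 (≤⇒0≤- u≤t)
    t-u-bound z (inj₂ (k , refl)) =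
      0≤-⇒≤ (≤-cong refl (trans (cong (λ c → t - c * u) (fromℕ-suc k)) (regroup t u (fromℕ k)))
                         (≤⇒0≤- (upper _ (inj₂ (suc k , refl)))))
      where
      regroup : ∀ t u k → t - (1# + k) * u ≡ t - u - k * u
      regroup = solve 3 (λ t u k → t :- (con +[ 1 ] :+ k) :* u := t :- u :- k :* u) refl

    t≤t-u : t ≤ t - u
    t≤t-u = least (t - u) t-u-bound

    t-u-t : ∀ t u → t - u - t ≡ - u
    t-u-t = solve 2 (λ t u → t :- u :- t := :- u) refl
    negate-back : ∀ u → - - u ≡ u
    negate-back = solve 1 (λ u → :- :- u := u) refl

  square≡0 : ∀ {x} → x * x ≡ 0# → x ≡ 0#
  square≡0 {x} x²≡0 with ≤-total 0# x
  ... | inj₁ 0≤x = ≤-antisym (nilpotent⇒≤0 0≤x x²≡0) 0≤x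
  ... | inj₂ x≤0 = ≤-antisym x≤0 (≤-cong refl (-‿involutive x) (≤0⇒0≤- (nilpotent⇒≤0 (≤0⇒0≤- x≤0) (trans (neg-square x) x²≡0))))
    where
    neg-square : ∀ x → - x * - x ≡ x * x
    neg-square = solve 1 (λ x → :- x :* :- x := x :* x) refl

  square-mono : ∀ {p q} → 0# ≤ p → p ≤ q → p * p ≤ q * q
  square-mono {p} {q} 0≤p p≤q =
    0≤-⇒≤ (≤-cong refl (difference-of-squares q p) (*-nonneg (≤⇒0≤- p≤q) (0≤+ (≤-trans 0≤p p≤q) 0≤p)))
    where
    difference-of-squares : ∀ q p → (q - p) * (q + p) ≡ q * q - p * p
    difference-of-squares = solve 2 (λ q p → (q :- p) :* (q :+ p) := q :* q :- p :* p) refl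

  square-root-mono : ∀ {y b} → 0# ≤ b → y * y ≤ b * b → y ≤ b
  square-root-mono {y} {b} 0≤b y²≤b² with ≤-total y b
  ... | inj₁ y≤b = y≤b
  ... | inj₂ b≤y = -≤0⇒≤ (nilpotent⇒≤0 (≤⇒0≤- b≤y) (≤-antisym square≤0 (0≤square _)))
    where
    expand : ∀ y b → (y - b) * (y - b) ≡ (y * y - b * b) - two * b * (y - b)
    expand = solve 2 (λ y b → (y :- b) :* (y :- b) := (y :* y :- b :* b) :- con +[ 2 ] :* b :* (y :- b)) refl
    square≤0 : (y - b) * (y - b) ≤ 0#
    square≤0 = ≤-cong (sym (expand y b)) (+-identityʳ 0#)
      (+-mono (≤⇒-≤0 y²≤b²) (0≤⇒-≤0 (*-nonneg (*-nonneg 0≤two 0≤b) (≤⇒0≤- b≤y))))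

  -- For x > 0 let s be the supremum of { y | y² ≤ x }.
  -- If s² ≤ x, then s + δ with δ = (x − s²)/(1 + 2s + x − s²) still lies in
  -- the set, so δ = 0 and s² = x.  If x ≤ s², then b = (s² + x)/(2s) is a
  -- smaller upper bound than s unless s² = x.
  module SquareRoot (x : Carrier) (0≤x : 0# ≤ x) (x≢0 : x ≢ 0#) where
    Below : Carrier → Set
    Below y = y * y ≤ x

    -- the set is bounded by 1 + x, because (1 + x)² exceeds x
    bounded : ∀ y → Below y → y ≤ 1# + x
    bounded y y²≤x with ≤-total y (1# + x)
    ... | inj₁ y≤1+x = y≤1+x
    ... | inj₂ 1+x≤y = ⊥-elim (1≰0 (≤-trans 1≤-[x+x²] (0≤⇒-≤0 (0≤+ 0≤x (0≤square x)))))
      where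
      0≤1+x : 0# ≤ 1# + x
      0≤1+x = 0≤+ 0≤1 0≤x
      excess : ∀ x → (1# + x) * (1# + x) - x ≡ 1# - - (x + x * x)
      excess = solve 1 (λ x → (con +[ 1 ] :+ x) :* (con +[ 1 ] :+ x) :- x := con +[ 1 ] :- :- (x :+ x :* x)) refl
      1≤-[x+x²] : 1# ≤ - (x + x * x)
      1≤-[x+x²] = -≤0⇒≤ (≤-cong (excess x) refl (≤⇒-≤0 (≤-trans (square-mono 0≤1+x 1+x≤y) y²≤x)))

    -- a positive element of the set: 1 if 1 ≤ x, and x itself otherwise
    positive-member : Σ Carrier λ m → Below m × 0# ≤ m × m ≢ 0#
    positive-member with ≤-total 1# x
    ... | inj₁ 1≤x = 1# , ≤-cong (sym (*-identityˡ 1#)) refl 1≤x , 0≤1 , 1≢0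
    ... | inj₂ x≤1 = x , 0≤-⇒≤ (≤-cong refl (factor x) (*-nonneg 0≤x (≤⇒0≤- x≤1))) , 0≤x , x≢0
      where
      factor : ∀ x → x * (1# - x) ≡ x - x * x
      factor = solve 1 (λ x → x :* (con +[ 1 ] :- x) := x :- x :* x) refl

    m : Carrier
    m = proj₁ positive-member

    open Supremum Below (m , proj₁ (proj₂ positive-member)) (1# + x , bounded) public
      renaming (supremum to s)

    m≤s : m ≤ s
    m≤s = upper m (proj₁ (proj₂ positive-member))

    0≤s : 0# ≤ s
    0≤s = ≤-trans (proj₁ (proj₂ (proj₂ positive-member))) m≤s

    s≢0 : s ≢ 0#
    s≢0 s≡0 = proj₂ (proj₂ (proj₂ positive-member))
      (≤-antisym (≤-cong refl s≡0 m≤s) (proj₁ (proj₂ (proj₂ positive-member))))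

    s²≤x⇒x≤s² : s * s ≤ x → x ≤ s * s
    s²≤x⇒x≤s² s²≤x = ≤-cong refl (sym s²≡x) (≤-refl x)
      where
      X : Carrier
      X = x - s * s
      0≤X : 0# ≤ X
      0≤X = ≤⇒0≤- s²≤x
      D : Carrier
      D = 1# + (two * s + X)
      D≢0 : D ≢ 0#
      D≢0 = positive+nonneg≢0 0≤1 1≢0 (0≤+ (*-nonneg 0≤two 0≤s) 0≤X)
      δ : Carrier
      δ = X * D ⁻¹⟨ D≢0 ⟩
      0≤δ : 0# ≤ δ
      0≤δ = *-nonneg 0≤X (⁻¹-nonneg D≢0 (0≤+ 0≤1 (0≤+ (*-nonneg 0≤two 0≤s) 0≤X)))
      δD≡X : δ * D ≡ X
      δD≡X = begin
        (X * D⁻¹) * D   ≡⟨ solve 3 (λ X i D → (X :* i) :* D := X :* (D :* i)) refl X D⁻¹ D ⟩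
        X * (D * D⁻¹)   ≡⟨ cong (X *_) (*-inverseʳ D D≢0) ⟩
        X * 1#          ≡⟨ *-identityʳ X ⟩
        X               ∎
        where
        open ≡-Reasoning
        D⁻¹ : Carrier
        D⁻¹ = D ⁻¹⟨ D≢0 ⟩
      -- x − (s + δ)² = δ (1 + X − δ)  and  X − δ = δ (2s + X)
      gap : x - (s + δ) * (s + δ) ≡ δ * (1# + (X - δ))
      gap = begin
        x - (s + δ) * (s + δ)             ≡⟨ solve 3 (λ x s δ → x :- (s :+ δ) :* (s :+ δ) := (x :- s :* s) :- δ :* (con +[ 2 ] :* s :+ δ)) refl x s δ ⟩
        X - δ * (two * s + δ)             ≡⟨ cong (_- δ * (two * s + δ)) (sym δD≡X) ⟩
        δ * D - δ * (two * s + δ)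
          ≡⟨ solve 3 (λ δ s X → δ :* (con +[ 1 ] :+ (con +[ 2 ] :* s :+ X)) :- δ :* (con +[ 2 ] :* s :+ δ)
                                  := δ :* (con +[ 1 ] :+ (X :- δ))) refl δ s X ⟩
        δ * (1# + (X - δ))                ∎
        where open ≡-Reasoning
      X-δ : X - δ ≡ δ * (two * s + X)
      X-δ = begin
        X - δ                   ≡⟨ cong (_- δ) (sym δD≡X) ⟩
        δ * D - δ               ≡⟨ solve 3 (λ δ s X → δ :* (con +[ 1 ] :+ (con +[ 2 ] :* s :+ X)) :- δ := δ :* (con +[ 2 ] :* s :+ X)) refl δ s X ⟩
        δ * (two * s + X)       ∎
        where open ≡-Reasoning
      s+δ-below : Below (s + δ)
      s+δ-below = 0≤-⇒≤ (≤-cong refl (sym gap) (*-nonneg 0≤δ (0≤+ 0≤1 (≤-cong refl (sym X-δ) (*-nonneg 0≤δ (0≤+ (*-nonneg 0≤two 0≤s) 0≤X))))))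
      δ≡0 : δ ≡ 0#
      δ≡0 = ≤-antisym (≤-cong (solve 2 (λ s δ → s :+ δ :- s := δ) refl s δ) (-‿inverseʳ s) (+-mono-≤ (- s) (upper (s + δ) s+δ-below))) 0≤δ
      s²≡x : s * s ≡ x
      s²≡x = begin
        s * s             ≡⟨ solve 2 (λ s x → s :* s := x :- (x :- s :* s)) refl s x ⟩
        x - X             ≡⟨ cong (λ z → x - z) (trans (sym δD≡X) (trans (cong (_* D) δ≡0) (zeroˡ D))) ⟩
        x - 0#            ≡⟨ solve 1 (λ x → x :- con +[ 0 ] := x) refl x ⟩
        x                 ∎
        where open ≡-Reasoning

    x≤s²⇒s²≤x : x ≤ s * s → s * s ≤ x
    x≤s²⇒s²≤x x≤s² = -≤0⇒≤ (≤-cong (sym E≡0) refl (≤-refl 0#))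
      where
      E : Carrier
      E = s * s - x
      0≤E : 0# ≤ E
      0≤E = ≤⇒0≤- x≤s²
      2s≢0 : two * s ≢ 0#
      2s≢0 = *-≢0 two≢0 s≢0
      i : Carrier
      i = (two * s) ⁻¹⟨ 2s≢0 ⟩
      0≤i : 0# ≤ i
      0≤i = ⁻¹-nonneg 2s≢0 (*-nonneg 0≤two 0≤s)
      2si≡1 : two * s * i ≡ 1#
      2si≡1 = *-inverseʳ (two * s) 2s≢0
      b : Carrier
      b = (s * s + x) * i
      -- b² − x = (E i)²  and  s − b = E i, using 2 s i = 1
      b²-x : b * b - x ≡ (E * i) * (E * i)
      b²-x = begin
        b * b - x
          ≡⟨ solve 3 (λ s x i → (s :* s :+ x) :* i :* ((s :* s :+ x) :* i) :- x
                                  := ((s :* s :- x) :* i) :* ((s :* s :- x) :* i)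
                                     :+ x :* ((con +[ 2 ] :* s :* i) :* (con +[ 2 ] :* s :* i) :- con +[ 1 ])) refl s x i ⟩
        (E * i) * (E * i) + x * (two * s * i * (two * s * i) - 1#)
                                                      ≡⟨ cong (λ z → (E * i) * (E * i) + x * (z * z - 1#)) 2si≡1 ⟩
        (E * i) * (E * i) + x * (1# * 1# - 1#)        ≡⟨ solve 2 (λ y x → y :+ x :* (con +[ 1 ] :* con +[ 1 ] :- con +[ 1 ]) := y) refl ((E * i) * (E * i)) x ⟩
        (E * i) * (E * i)                             ∎
        where open ≡-Reasoning
      s-b : s - b ≡ E * i
      s-b = begin
        s - b                        ≡⟨ cong (_- b) (sym (trans (cong (s *_) 2si≡1) (*-identityʳ s))) ⟩
        s * (two * s * i) - b        ≡⟨ solve 3 (λ s x i → s :* (con +[ 2 ] :* s :* i) :- (s :* s :+ x) :* i := (s :* s :- x) :* i) refl s x i ⟩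
        E * i                        ∎
        where open ≡-Reasoning
      b-upper : ∀ y → Below y → y ≤ b
      b-upper y y²≤x = square-root-mono (*-nonneg (0≤+ (0≤square s) 0≤x) 0≤i)
        (≤-trans y²≤x (0≤-⇒≤ (≤-cong refl (sym b²-x) (0≤square (E * i)))))
      Ei≡0 : E * i ≡ 0#
      Ei≡0 = ≤-antisym (≤-cong (s-b) (-‿inverseʳ b) (+-mono-≤ (- b) (least b b-upper))) (*-nonneg 0≤E 0≤i)
      E≡0 : E ≡ 0#
      E≡0 = *-cancelˡ-0 (⁻¹-≢0 2s≢0) (trans (*-comm i E) Ei≡0)

    s²≡x : s * s ≡ x
    s²≡x with ≤-total (s * s) x
    ... | inj₁ s²≤x = ≤-antisym s²≤x (s²≤x⇒x≤s² s²≤x)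
    ... | inj₂ x≤s² = ≤-antisym (x≤s²⇒s²≤x x≤s²) x≤s²

  √ : ∀ x → 0# ≤ x → x ≢ 0# → Σ Carrier λ s → s * s ≡ x
  √ x 0≤x x≢0 = s , s²≡x
    where open SquareRoot x 0≤x x≢0

-- Equality of reals is not
-- decidable, so "candidate k violates constraint q" is measured by a
-- nonnegative real g k q that vanishes exactly on violation.
module FiniteSelection (ℝ : RealNumbers) where
  open OrderedField ℝ

  argmax : ∀ m (g : Fin (suc m) → Carrier) → Σ (Fin (suc m)) λ k → ∀ j → g j ≤ g k
  argmax zero    g = zero , λ { zero → ≤-refl _ }
  argmax (suc m) g with argmax m (λ j → g (suc j))
  ... | k , max with ≤-total (g zero) (g (suc k))
  ...   | inj₁ g₀≤gₖ = suc k , λ { zero → g₀≤gₖ ; (suc j) → max j }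
  ...   | inj₂ gₖ≤g₀ = zero  , λ { zero → ≤-refl _ ; (suc j) → ≤-trans (max j) gₖ≤g₀ }

  argmin : ∀ m (g : Fin (suc m) → Carrier) → Σ (Fin (suc m)) λ k → ∀ j → g k ≤ g j
  argmin zero    g = zero , λ { zero → ≤-refl _ }
  argmin (suc m) g with argmin m (λ j → g (suc j))
  ... | k , min with ≤-total (g zero) (g (suc k))
  ...   | inj₁ g₀≤gₖ = zero  , λ { zero → ≤-refl _ ; (suc j) → ≤-trans g₀≤gₖ (min j) }
  ...   | inj₂ gₖ≤g₀ = suc k , λ { zero → gₖ≤g₀ ; (suc j) → min j }

  -- If each of C constraints is violated by at most one of C + 1
  -- candidates, some candidate satisfies all constraints: take the
  -- candidate whose worst constraint is best; if even that worst value
  -- vanished, every candidate would violate some constraint, and by the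
  -- pigeonhole principle two candidates would violate the same one.
  avoid : ∀ C (g : Fin (suc C) → Fin C → Carrier) → (∀ k q → 0# ≤ g k q) →
          (∀ k l q → k F.< l → g k q ≡ 0# → g l q ≡ 0# → ⊥) →
          Σ (Fin (suc C)) λ k → ∀ q → g k q ≢ 0#
  avoid zero    g 0≤g unique = zero , λ ()
  avoid (suc T) g 0≤g unique = best , best-satisfies
    where
    worst : Fin (suc (suc T)) → Fin (suc T)
    worst k = proj₁ (argmin T (g k))

    score : Fin (suc (suc T)) → Carrier
    score k = g k (worst k)

    best : Fin (suc (suc T))
    best = proj₁ (argmax (suc T) score)

    best-satisfies : ∀ q → g best q ≢ 0#
    best-satisfies q gq≡0 with FP.pigeonhole (ℕP.n<1+n (suc T)) worst
    ... | k , l , k<l , same-worst = unique k l (worst k) k<l (violated k) (subst (λ r → g l r ≡ 0#) (sym same-worst) (violated l))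
      where
      violated : ∀ k → g k (worst k) ≡ 0#
      violated k = ≤-antisym (≤-trans (proj₂ (argmax (suc T) score) k) (≤-trans (proj₂ (argmin T (g best)) q) (≤-cong refl gq≡0 (≤-refl _)))) (0≤g k (worst k))

-- It is instantiated twice: with the real numbers, and with
-- the solver's polynomial expressions, so that a vector identity becomes a
-- polynomial identity that the ring solver proves.
module VectorOperations {A : Set} (_⊕_ _⊗_ : A → A → A) (⊝_ : A → A) (zero′ two′ : A) where
  infixl 6 _⊕ᵥ_
  infix 7 _∙_

  Vector : Set
  Vector = A × A × A

  0ᵥ : Vector
  0ᵥ = (zero′ , zero′ , zero′)

  _∙_ : Vector → Vector → A
  (a , b , c) ∙ (x , y , z) = ((a ⊗ x) ⊕ (b ⊗ y)) ⊕ (c ⊗ z)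

  ‖_‖² : Vector → A
  ‖ x ‖² = x ∙ x

  _⊕ᵥ_ : Vector → Vector → Vector
  (a , b , c) ⊕ᵥ (x , y , z) = (a ⊕ x , b ⊕ y , c ⊕ z)

  _·ᵥ_ : A → Vector → Vector
  t ·ᵥ (x , y , z) = (t ⊗ x , t ⊗ y , t ⊗ z)

  _×ᵥ_ : Vector → Vector → Vector
  (a , b , c) ×ᵥ (x , y , z) = ((b ⊗ z) ⊕ (⊝ (c ⊗ y)) , (c ⊗ x) ⊕ (⊝ (a ⊗ z)) , (a ⊗ y) ⊕ (⊝ (b ⊗ x)))

  -- The rotation of ℝ³ given by the (unnormalised) quaternion w + u,
  -- scaled by its squared norm  w² + ‖u‖²:
  --   x ↦ (w² − ‖u‖²) x + 2 (u·x) u + 2 w (u × x).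
  rotation : A → Vector → Vector → Vector
  rotation w u x = ((((w ⊗ w) ⊕ (⊝ ‖ u ‖²)) ·ᵥ x) ⊕ᵥ ((two′ ⊗ (u ∙ x)) ·ᵥ u)) ⊕ᵥ ((two′ ⊗ w) ·ᵥ (u ×ᵥ x))

module Space (ℝ : RealNumbers) where
  open OrderedField ℝ public
  open FiniteSelection ℝ public
  open VectorOperations _+_ _*_ -_ 0# two public
  private
    module E {n} = VectorOperations {Polynomial n} _:+_ _:*_ :-_ (con +[ 0 ]) (con +[ 2 ])

  coordinates : ∀ a b c → ((a , b , c) ∙ (1# , 0# , 0#) ≡ a)
                        × ((a , b , c) ∙ (0# , 1# , 0#) ≡ b)
                        × ((a , b , c) ∙ (0# , 0# , 1#) ≡ c)
  coordinates a b c =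
      solve 3 (λ a b c → (a , b , c) E.∙ (con +[ 1 ] , con +[ 0 ] , con +[ 0 ]) := a) refl a b c
    , solve 3 (λ a b c → (a , b , c) E.∙ (con +[ 0 ] , con +[ 1 ] , con +[ 0 ]) := b) refl a b c
    , solve 3 (λ a b c → (a , b , c) E.∙ (con +[ 0 ] , con +[ 0 ] , con +[ 1 ]) := c) refl a b c

  ∙-ext : ∀ {x y} → (∀ z → x ∙ z ≡ y ∙ z) → x ≡ y
  ∙-ext {x₁ , x₂ , x₃} {y₁ , y₂ , y₃} same with coordinates x₁ x₂ x₃ | coordinates y₁ y₂ y₃
  ... | x₁≡ , x₂≡ , x₃≡ | y₁≡ , y₂≡ , y₃≡ =
    cong₂ _,_ (component x₁≡ y₁≡) (cong₂ _,_ (component x₂≡ y₂≡) (component x₃≡ y₃≡))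
    where
    component : ∀ {e a b} → (x₁ , x₂ , x₃) ∙ e ≡ a → (y₁ , y₂ , y₃) ∙ e ≡ b → a ≡ b
    component {e} x∙e≡a y∙e≡b = trans (sym x∙e≡a) (trans (same e) y∙e≡b)

  ∙-comm : ∀ x y → x ∙ y ≡ y ∙ x
  ∙-comm (x₁ , x₂ , x₃) (y₁ , y₂ , y₃) =
    solve 6 (λ x₁ x₂ x₃ y₁ y₂ y₃ → (x₁ , x₂ , x₃) E.∙ (y₁ , y₂ , y₃) := (y₁ , y₂ , y₃) E.∙ (x₁ , x₂ , x₃))
      refl x₁ x₂ x₃ y₁ y₂ y₃

  ∙-scaleˡ : ∀ t x y → (t ·ᵥ x) ∙ y ≡ t * (x ∙ y)
  ∙-scaleˡ t (x₁ , x₂ , x₃) (y₁ , y₂ , y₃) =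
    solve 7 (λ t x₁ x₂ x₃ y₁ y₂ y₃ → (t E.·ᵥ (x₁ , x₂ , x₃)) E.∙ (y₁ , y₂ , y₃) := t :* ((x₁ , x₂ , x₃) E.∙ (y₁ , y₂ , y₃)))
      refl t x₁ x₂ x₃ y₁ y₂ y₃

  ∙-scaleʳ : ∀ t x y → x ∙ (t ·ᵥ y) ≡ t * (x ∙ y)
  ∙-scaleʳ t x y = trans (∙-comm x (t ·ᵥ y)) (trans (∙-scaleˡ t y x) (cong (t *_) (∙-comm y x)))

  ∙-⊕ : ∀ x y z → x ∙ (y ⊕ᵥ z) ≡ x ∙ y + x ∙ z
  ∙-⊕ (x₁ , x₂ , x₃) (y₁ , y₂ , y₃) (z₁ , z₂ , z₃) =
    solve 9 (λ x₁ x₂ x₃ y₁ y₂ y₃ z₁ z₂ z₃ →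
      (x₁ , x₂ , x₃) E.∙ ((y₁ , y₂ , y₃) E.⊕ᵥ (z₁ , z₂ , z₃))
        := ((x₁ , x₂ , x₃) E.∙ (y₁ , y₂ , y₃)) :+ ((x₁ , x₂ , x₃) E.∙ (z₁ , z₂ , z₃)))
      refl x₁ x₂ x₃ y₁ y₂ y₃ z₁ z₂ z₃

  ·ᵥ-assoc : ∀ s t x → s ·ᵥ (t ·ᵥ x) ≡ (s * t) ·ᵥ x
  ·ᵥ-assoc s t (x₁ , x₂ , x₃) = sym (cong₂ _,_ (*-assoc s t x₁) (cong₂ _,_ (*-assoc s t x₂) (*-assoc s t x₃)))

  ∙-scale : ∀ s t x y → (s ·ᵥ x) ∙ (t ·ᵥ y) ≡ (s * t) * (x ∙ y)
  ∙-scale s t x y = begin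
    (s ·ᵥ x) ∙ (t ·ᵥ y)     ≡⟨ ∙-scaleˡ s x (t ·ᵥ y) ⟩
    s * (x ∙ (t ·ᵥ y))      ≡⟨ cong (s *_) (∙-scaleʳ t x y) ⟩
    s * (t * (x ∙ y))       ≡⟨ sym (*-assoc s t _) ⟩
    (s * t) * (x ∙ y)       ∎
    where open ≡-Reasoning

  0ᵥ-∙ : ∀ x → 0ᵥ ∙ x ≡ 0#
  0ᵥ-∙ (x₁ , x₂ , x₃) = solve 3 (λ x₁ x₂ x₃ → E.0ᵥ E.∙ (x₁ , x₂ , x₃) := con +[ 0 ]) refl x₁ x₂ x₃

  0≤‖‖² : ∀ x → 0# ≤ ‖ x ‖²
  0≤‖‖² (x₁ , x₂ , x₃) = 0≤+ (0≤+ (0≤square x₁) (0≤square x₂)) (0≤square x₃)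

  ‖‖²≡0 : ∀ {x} → ‖ x ‖² ≡ 0# → x ≡ 0ᵥ
  ‖‖²≡0 {x₁ , x₂ , x₃} ‖x‖²≡0
    with nonneg-sum≡0 (0≤+ (0≤square x₁) (0≤square x₂)) (0≤square x₃) ‖x‖²≡0
  ... | x₁²+x₂²≡0 , x₃²≡0 with nonneg-sum≡0 (0≤square x₁) (0≤square x₂) x₁²+x₂²≡0
  ... | x₁²≡0 , x₂²≡0 = cong₂ _,_ (square≡0 x₁²≡0) (cong₂ _,_ (square≡0 x₂²≡0) (square≡0 x₃²≡0))

  ‖‖²≢0 : ∀ {x} → x ≢ 0ᵥ → ‖ x ‖² ≢ 0#
  ‖‖²≢0 x≢0 ‖x‖²≡0 = x≢0 (‖‖²≡0 ‖x‖²≡0)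

  ‖‖²-scale : ∀ t x → ‖ t ·ᵥ x ‖² ≡ (t * t) * ‖ x ‖²
  ‖‖²-scale t (x₁ , x₂ , x₃) =
    solve 4 (λ t x₁ x₂ x₃ → E.‖ t E.·ᵥ (x₁ , x₂ , x₃) ‖² := (t :* t) :* E.‖ (x₁ , x₂ , x₃) ‖²) refl t x₁ x₂ x₃

  binet-cauchy : ∀ a x z → (a ×ᵥ x) ∙ (a ×ᵥ z) ≡ ‖ a ‖² * (x ∙ z) - (a ∙ x) * (a ∙ z)
  binet-cauchy (a₁ , a₂ , a₃) (x₁ , x₂ , x₃) (z₁ , z₂ , z₃) =
    solve 9 (λ a₁ a₂ a₃ x₁ x₂ x₃ z₁ z₂ z₃ →
      ((a₁ , a₂ , a₃) E.×ᵥ (x₁ , x₂ , x₃)) E.∙ ((a₁ , a₂ , a₃) E.×ᵥ (z₁ , z₂ , z₃))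
        := E.‖ (a₁ , a₂ , a₃) ‖² :* ((x₁ , x₂ , x₃) E.∙ (z₁ , z₂ , z₃))
           :- ((a₁ , a₂ , a₃) E.∙ (x₁ , x₂ , x₃)) :* ((a₁ , a₂ , a₃) E.∙ (z₁ , z₂ , z₃)))
      refl a₁ a₂ a₃ x₁ x₂ x₃ z₁ z₂ z₃

  lagrange : ∀ a x → ‖ a ×ᵥ x ‖² ≡ ‖ a ‖² * ‖ x ‖² - (a ∙ x) * (a ∙ x)
  lagrange a x = binet-cauchy a x x

  ×-scaleˡ : ∀ t x y → ‖ (t ·ᵥ x) ×ᵥ y ‖² ≡ (t * t) * ‖ x ×ᵥ y ‖²
  ×-scaleˡ t x y = begin
    ‖ (t ·ᵥ x) ×ᵥ y ‖²                                          ≡⟨ lagrange (t ·ᵥ x) y ⟩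
    ‖ t ·ᵥ x ‖² * ‖ y ‖² - ((t ·ᵥ x) ∙ y) * ((t ·ᵥ x) ∙ y)      ≡⟨ cong₂ (λ p q → p * ‖ y ‖² - q * q) (‖‖²-scale t x) (∙-scaleˡ t x y) ⟩
    ((t * t) * ‖ x ‖²) * ‖ y ‖² - (t * (x ∙ y)) * (t * (x ∙ y))
      ≡⟨ solve 4 (λ t p q d → ((t :* t) :* p) :* q :- (t :* d) :* (t :* d) := (t :* t) :* (p :* q :- d :* d))
           refl t ‖ x ‖² ‖ y ‖² (x ∙ y) ⟩
    (t * t) * (‖ x ‖² * ‖ y ‖² - (x ∙ y) * (x ∙ y))             ≡⟨ cong ((t * t) *_) (sym (lagrange x y)) ⟩
    (t * t) * ‖ x ×ᵥ y ‖²                                       ∎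
    where open ≡-Reasoning

  -- Two vectors are parallel when their cross product vanishes; measuring
  -- this by the squared length keeps it a statement about one real number.
  Parallel : Vector → Vector → Set
  Parallel x y = ‖ x ×ᵥ y ‖² ≡ 0#

  parallel-sym : ∀ {x y} → Parallel x y → Parallel y x
  parallel-sym {x} {y} x∥y = begin
    ‖ y ×ᵥ x ‖²                                ≡⟨ lagrange y x ⟩
    ‖ y ‖² * ‖ x ‖² - (y ∙ x) * (y ∙ x)        ≡⟨ cong₂ (λ p q → p - q * q) (*-comm _ _) (∙-comm y x) ⟩
    ‖ x ‖² * ‖ y ‖² - (x ∙ y) * (x ∙ y)        ≡⟨ sym (lagrange x y) ⟩
    ‖ x ×ᵥ y ‖²                                ≡⟨ x∥y ⟩
    0#                                         ∎
    where open ≡-Reasoning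

  multiple⇒parallel : ∀ t x → Parallel (t ·ᵥ x) x
  multiple⇒parallel t (x₁ , x₂ , x₃) =
    solve 4 (λ t x₁ x₂ x₃ → E.‖ (t E.·ᵥ (x₁ , x₂ , x₃)) E.×ᵥ (x₁ , x₂ , x₃) ‖² := con +[ 0 ]) refl t x₁ x₂ x₃

  sameLine⇒parallel : ∀ {x y} → SameLine ℝ x y → Parallel x y
  sameLine⇒parallel {x} {y} (t , x≡ty) = subst (λ z → Parallel z y) (sym x≡ty) (multiple⇒parallel t y)

  parallel⇒multiple : ∀ {a x} → a ≢ 0ᵥ → Parallel a x → Σ Carrier λ t → x ≡ t ·ᵥ a
  parallel⇒multiple {a} {x} a≢0 a∥x = i * (a ∙ x) , ∙-ext λ z → begin
      x ∙ z
        ≡⟨ sym (*-identityˡ _) ⟩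
      1# * (x ∙ z)
        ≡⟨ cong (_* (x ∙ z)) (sym (*-inverseʳ ‖ a ‖² ‖a‖²≢0)) ⟩
      (‖ a ‖² * i) * (x ∙ z)
        ≡⟨ solve 3 (λ n i p → (n :* i) :* p := i :* (n :* p :- con +[ 0 ])) refl ‖ a ‖² i (x ∙ z) ⟩
      i * (‖ a ‖² * (x ∙ z) - 0#)
        ≡⟨ cong (λ c → i * (‖ a ‖² * (x ∙ z) - c)) (sym (trans (cong (_∙ (a ×ᵥ z)) a×x≡0) (0ᵥ-∙ _))) ⟩
      i * (‖ a ‖² * (x ∙ z) - (a ×ᵥ x) ∙ (a ×ᵥ z))
        ≡⟨ cong (λ c → i * (‖ a ‖² * (x ∙ z) - c)) (binet-cauchy a x z) ⟩
      i * (‖ a ‖² * (x ∙ z) - (‖ a ‖² * (x ∙ z) - (a ∙ x) * (a ∙ z)))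
        ≡⟨ solve 4 (λ i p q r → i :* (p :- (p :- q :* r)) := (i :* q) :* r) refl i (‖ a ‖² * (x ∙ z)) (a ∙ x) (a ∙ z) ⟩
      (i * (a ∙ x)) * (a ∙ z)
        ≡⟨ sym (∙-scaleˡ _ a z) ⟩
      ((i * (a ∙ x)) ·ᵥ a) ∙ z ∎
    where
    open ≡-Reasoning
    ‖a‖²≢0 : ‖ a ‖² ≢ 0#
    ‖a‖²≢0 = ‖‖²≢0 a≢0
    i : Carrier
    i = ‖ a ‖² ⁻¹⟨ ‖a‖²≢0 ⟩
    a×x≡0 : a ×ᵥ x ≡ 0ᵥ
    a×x≡0 = ‖‖²≡0 a∥x

  parallel-trans : ∀ {u v w} → w ≢ 0ᵥ → Parallel u w → Parallel w v → Parallel u v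
  parallel-trans {u} {v} {w} w≢0 u∥w w∥v =
    subst₂ Parallel (sym (proj₂ u-multiple)) (sym (proj₂ v-multiple)) (multiples-parallel (proj₁ u-multiple) (proj₁ v-multiple) w)
    where
    u-multiple : Σ Carrier λ s → u ≡ s ·ᵥ w
    u-multiple = parallel⇒multiple w≢0 (parallel-sym u∥w)
    v-multiple : Σ Carrier λ t → v ≡ t ·ᵥ w
    v-multiple = parallel⇒multiple w≢0 w∥v
    multiples-parallel : ∀ s t w → Parallel (s ·ᵥ w) (t ·ᵥ w)
    multiples-parallel s t w = begin
      ‖ (s ·ᵥ w) ×ᵥ (t ·ᵥ w) ‖²                                  ≡⟨ lagrange (s ·ᵥ w) (t ·ᵥ w) ⟩
      ‖ s ·ᵥ w ‖² * ‖ t ·ᵥ w ‖² - ((s ·ᵥ w) ∙ (t ·ᵥ w)) * ((s ·ᵥ w) ∙ (t ·ᵥ w))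
        ≡⟨ cong₂ (λ p q → p - q * q) (cong₂ _*_ (‖‖²-scale s w) (‖‖²-scale t w)) (∙-scale s t w w) ⟩
      ((s * s) * ‖ w ‖²) * ((t * t) * ‖ w ‖²) - ((s * t) * ‖ w ‖²) * ((s * t) * ‖ w ‖²)
        ≡⟨ solve 3 (λ s t n → ((s :* s) :* n) :* ((t :* t) :* n) :- ((s :* t) :* n) :* ((s :* t) :* n) := con +[ 0 ])
             refl s t ‖ w ‖² ⟩
      0#                                                         ∎
      where open ≡-Reasoning

  -- every nonzero vector has a nonzero orthogonal vector: one of the three
  -- vectors below, whose squared lengths add up to 2 ‖a‖²
  orthogonal-vector : ∀ {a} → a ≢ 0ᵥ → Σ Vector λ c → a ∙ c ≡ 0# × c ≢ 0ᵥ
  orthogonal-vector {a@(a₁ , a₂ , a₃)} a≢0 = c , a⊥c , c≢0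
    where
    candidate : Fin 3 → Vector
    candidate zero             = (a₂ , - a₁ , 0#)
    candidate (suc zero)       = (a₃ , 0# , - a₁)
    candidate (suc (suc zero)) = (0# , a₃ , - a₂)

    orthogonal : ∀ k → a ∙ candidate k ≡ 0#
    orthogonal zero             = solve 3 (λ a₁ a₂ a₃ → (a₁ , a₂ , a₃) E.∙ (a₂ , :- a₁ , con +[ 0 ]) := con +[ 0 ]) refl a₁ a₂ a₃
    orthogonal (suc zero)       = solve 3 (λ a₁ a₂ a₃ → (a₁ , a₂ , a₃) E.∙ (a₃ , con +[ 0 ] , :- a₁) := con +[ 0 ]) refl a₁ a₂ a₃
    orthogonal (suc (suc zero)) = solve 3 (λ a₁ a₂ a₃ → (a₁ , a₂ , a₃) E.∙ (con +[ 0 ] , a₃ , :- a₂) := con +[ 0 ]) refl a₁ a₂ a₃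

    total-length : ‖ candidate zero ‖² + ‖ candidate (suc zero) ‖² + ‖ candidate (suc (suc zero)) ‖² ≡ two * ‖ a ‖²
    total-length = solve 3 (λ a₁ a₂ a₃ →
      E.‖ (a₂ , :- a₁ , con +[ 0 ]) ‖² :+ E.‖ (a₃ , con +[ 0 ] , :- a₁) ‖² :+ E.‖ (con +[ 0 ] , a₃ , :- a₂) ‖²
        := con +[ 2 ] :* E.‖ (a₁ , a₂ , a₃) ‖²) refl a₁ a₂ a₃

    longest : Σ (Fin 3) λ k → ∀ j → ‖ candidate j ‖² ≤ ‖ candidate k ‖²
    longest = argmax 2 (λ k → ‖ candidate k ‖²)

    c : Vector
    c = candidate (proj₁ longest)

    a⊥c : a ∙ c ≡ 0#
    a⊥c = orthogonal (proj₁ longest)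

    c≢0 : c ≢ 0ᵥ
    c≢0 c≡0 = *-≢0 two≢0 (‖‖²≢0 a≢0) (begin
      two * ‖ a ‖²
        ≡⟨ sym total-length ⟩
      ‖ candidate zero ‖² + ‖ candidate (suc zero) ‖² + ‖ candidate (suc (suc zero)) ‖²
        ≡⟨ cong₂ _+_ (cong₂ _+_ (vanishes zero) (vanishes (suc zero))) (vanishes (suc (suc zero))) ⟩
      0# + 0# + 0#
        ≡⟨ solve 0 (con +[ 0 ] :+ con +[ 0 ] :+ con +[ 0 ] := con +[ 0 ]) refl ⟩
      0# ∎)
      where
      open ≡-Reasoning
      vanishes : ∀ j → ‖ candidate j ‖² ≡ 0#
      vanishes j = ≤-antisym (≤-trans (proj₂ longest j) (≤-cong refl (trans (cong ‖_‖² c≡0) (0ᵥ-∙ 0ᵥ)) (≤-refl _))) (0≤‖‖² _)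

  rescale : ∀ {b} α → 0# ≤ α → α ≢ 0# → b ≢ 0ᵥ → Σ Carrier λ s → s ≢ 0# × ‖ s ·ᵥ b ‖² ≡ α
  rescale {b} α 0≤α α≢0 b≢0 = s , s≢0 , (begin
      ‖ s ·ᵥ b ‖²             ≡⟨ ‖‖²-scale s b ⟩
      (s * s) * ‖ b ‖²        ≡⟨ cong (_* ‖ b ‖²) (proj₂ root) ⟩
      (α * i) * ‖ b ‖²        ≡⟨ solve 3 (λ α i n → (α :* i) :* n := α :* (n :* i)) refl α i ‖ b ‖² ⟩
      α * (‖ b ‖² * i)        ≡⟨ cong (α *_) (*-inverseʳ ‖ b ‖² (‖‖²≢0 b≢0)) ⟩
      α * 1#                  ≡⟨ *-identityʳ α ⟩
      α                       ∎)
    where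
    open ≡-Reasoning
    i : Carrier
    i = ‖ b ‖² ⁻¹⟨ ‖‖²≢0 b≢0 ⟩
    root : Σ Carrier λ s → s * s ≡ α * i
    root = √ (α * i) (*-nonneg 0≤α (⁻¹-nonneg (‖‖²≢0 b≢0) (0≤‖‖² b))) (*-≢0 α≢0 (⁻¹-≢0 (‖‖²≢0 b≢0)))
    s : Carrier
    s = proj₁ root
    s≢0 : s ≢ 0#
    s≢0 s≡0 = *-≢0 α≢0 (⁻¹-≢0 (‖‖²≢0 b≢0)) (trans (sym (proj₂ root)) (trans (cong (λ z → z * z) s≡0) (zeroˡ 0#)))

  rotation-∙ : ∀ w u x y → rotation w u x ∙ rotation w u y ≡ ((w * w + ‖ u ‖²) * (w * w + ‖ u ‖²)) * (x ∙ y)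
  rotation-∙ w (u₁ , u₂ , u₃) (x₁ , x₂ , x₃) (y₁ , y₂ , y₃) =
    solve 10 (λ w u₁ u₂ u₃ x₁ x₂ x₃ y₁ y₂ y₃ →
      E.rotation w (u₁ , u₂ , u₃) (x₁ , x₂ , x₃) E.∙ E.rotation w (u₁ , u₂ , u₃) (y₁ , y₂ , y₃)
        := ((w :* w :+ E.‖ (u₁ , u₂ , u₃) ‖²) :* (w :* w :+ E.‖ (u₁ , u₂ , u₃) ‖²)) :* ((x₁ , x₂ , x₃) E.∙ (y₁ , y₂ , y₃)))
      refl w u₁ u₂ u₃ x₁ x₂ x₃ y₁ y₂ y₃

  rotation-scale : ∀ w u t x → rotation w u (t ·ᵥ x) ≡ t ·ᵥ rotation w u x
  rotation-scale w u@(u₁ , u₂ , u₃) t x@(x₁ , x₂ , x₃) = ∙-ext λ z@(z₁ , z₂ , z₃) →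
    trans (solve 11 (λ w u₁ u₂ u₃ t x₁ x₂ x₃ z₁ z₂ z₃ →
             E.rotation w (u₁ , u₂ , u₃) (t E.·ᵥ (x₁ , x₂ , x₃)) E.∙ (z₁ , z₂ , z₃)
               := t :* (E.rotation w (u₁ , u₂ , u₃) (x₁ , x₂ , x₃) E.∙ (z₁ , z₂ , z₃)))
             refl w u₁ u₂ u₃ t x₁ x₂ x₃ z₁ z₂ z₃)
          (sym (∙-scaleˡ t (rotation w u x) z))

  rotation-axis : ∀ w a → rotation w a a ≡ (w * w + ‖ a ‖²) ·ᵥ a
  rotation-axis w a@(a₁ , a₂ , a₃) = ∙-ext λ z@(z₁ , z₂ , z₃) →
    trans (solve 7 (λ w a₁ a₂ a₃ z₁ z₂ z₃ →
             E.rotation w (a₁ , a₂ , a₃) (a₁ , a₂ , a₃) E.∙ (z₁ , z₂ , z₃)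
               := (w :* w :+ E.‖ (a₁ , a₂ , a₃) ‖²) :* ((a₁ , a₂ , a₃) E.∙ (z₁ , z₂ , z₃)))
             refl w a₁ a₂ a₃ z₁ z₂ z₃)
          (sym (∙-scaleˡ _ a z))

  axis-∙-rotation : ∀ w a x → a ∙ rotation w a x ≡ (w * w + ‖ a ‖²) * (a ∙ x)
  axis-∙-rotation w (a₁ , a₂ , a₃) (x₁ , x₂ , x₃) =
    solve 7 (λ w a₁ a₂ a₃ x₁ x₂ x₃ →
      (a₁ , a₂ , a₃) E.∙ E.rotation w (a₁ , a₂ , a₃) (x₁ , x₂ , x₃)
        := (w :* w :+ E.‖ (a₁ , a₂ , a₃) ‖²) :* ((a₁ , a₂ , a₃) E.∙ (x₁ , x₂ , x₃)))
      refl w a₁ a₂ a₃ x₁ x₂ x₃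

  -- Rotations about a with parameters w and v differ on every x that is
  -- not parallel to a: the triple product below vanishes only if w = v,
  -- w v = −‖a‖² or a ∥ x.
  rotations-about-axis : ∀ w v a x →
    a ∙ (rotation w a x ×ᵥ rotation v a x) ≡ two * (w - v) * (w * v + ‖ a ‖²) * ‖ a ×ᵥ x ‖²
  rotations-about-axis w v (a₁ , a₂ , a₃) (x₁ , x₂ , x₃) =
    solve 8 (λ w v a₁ a₂ a₃ x₁ x₂ x₃ →
      (a₁ , a₂ , a₃) E.∙ (E.rotation w (a₁ , a₂ , a₃) (x₁ , x₂ , x₃) E.×ᵥ E.rotation v (a₁ , a₂ , a₃) (x₁ , x₂ , x₃))
        := con +[ 2 ] :* (w :- v) :* (w :* v :+ E.‖ (a₁ , a₂ , a₃) ‖²) :* E.‖ (a₁ , a₂ , a₃) E.×ᵥ (x₁ , x₂ , x₃) ‖²)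
      refl w v a₁ a₂ a₃ x₁ x₂ x₃

  half-turn : ∀ a b → a ∙ b ≡ 0# → ‖ b ‖² ≡ ‖ a ‖² → rotation 0# (a ⊕ᵥ b) a ≡ (two * ‖ a ‖²) ·ᵥ b
  half-turn a@(a₁ , a₂ , a₃) b@(b₁ , b₂ , b₃) a⊥b ‖b‖²≡‖a‖² = ∙-ext λ z@(z₁ , z₂ , z₃) → begin
    rotation 0# (a ⊕ᵥ b) a ∙ z
      ≡⟨ solve 9 (λ a₁ a₂ a₃ b₁ b₂ b₃ z₁ z₂ z₃ →
           E.rotation (con +[ 0 ]) ((a₁ , a₂ , a₃) E.⊕ᵥ (b₁ , b₂ , b₃)) (a₁ , a₂ , a₃) E.∙ (z₁ , z₂ , z₃)
             := con +[ 2 ] :* E.‖ (a₁ , a₂ , a₃) ‖² :* ((b₁ , b₂ , b₃) E.∙ (z₁ , z₂ , z₃))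
                :+ ((E.‖ (a₁ , a₂ , a₃) ‖² :- E.‖ (b₁ , b₂ , b₃) ‖²) :* ((a₁ , a₂ , a₃) E.∙ (z₁ , z₂ , z₃))
                    :+ con +[ 2 ] :* ((a₁ , a₂ , a₃) E.∙ (b₁ , b₂ , b₃)) :* ((b₁ , b₂ , b₃) E.∙ (z₁ , z₂ , z₃))))
           refl a₁ a₂ a₃ b₁ b₂ b₃ z₁ z₂ z₃ ⟩
    two * ‖ a ‖² * (b ∙ z) + ((‖ a ‖² - ‖ b ‖²) * (a ∙ z) + two * (a ∙ b) * (b ∙ z))
      ≡⟨ cong₂ (λ p q → two * ‖ a ‖² * (b ∙ z) + ((‖ a ‖² - p) * (a ∙ z) + two * q * (b ∙ z))) ‖b‖²≡‖a‖² a⊥b ⟩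
    two * ‖ a ‖² * (b ∙ z) + ((‖ a ‖² - ‖ a ‖²) * (a ∙ z) + two * 0# * (b ∙ z))
      ≡⟨ solve 3 (λ n p q → con +[ 2 ] :* n :* q :+ ((n :- n) :* p :+ con +[ 2 ] :* con +[ 0 ] :* q) := con +[ 2 ] :* n :* q) refl ‖ a ‖² (a ∙ z) (b ∙ z) ⟩
    two * ‖ a ‖² * (b ∙ z)
      ≡⟨ sym (∙-scaleˡ _ b z) ⟩
    ((two * ‖ a ‖²) ·ᵥ b) ∙ z ∎
    where open ≡-Reasoning

  rotations-separate : ∀ {m n} {a} x → a ≢ 0ᵥ → m ℕ.< n →
    Parallel (rotation (fromℕ m) a x) (rotation (fromℕ n) a x) → Parallel a x
  rotations-separate {m} {n} {a} x a≢0 m<n parallel =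
    *-cancelˡ-0 factors≢0 (begin
      two * (fromℕ m - fromℕ n) * (fromℕ m * fromℕ n + ‖ a ‖²) * ‖ a ×ᵥ x ‖²
        ≡⟨ sym (rotations-about-axis (fromℕ m) (fromℕ n) a x) ⟩
      a ∙ (rotation (fromℕ m) a x ×ᵥ rotation (fromℕ n) a x)
        ≡⟨ cong (a ∙_) (‖‖²≡0 parallel) ⟩
      a ∙ 0ᵥ
        ≡⟨ trans (∙-comm a 0ᵥ) (0ᵥ-∙ a) ⟩
      0# ∎)
    where
    open ≡-Reasoning
    difference≢0 : fromℕ m - fromℕ n ≢ 0#
    difference≢0 e = ℕP.<⇒≢ m<n (fromℕ-injective (begin
      fromℕ m                       ≡⟨ solve 2 (λ p q → p := p :- q :+ q) refl (fromℕ m) (fromℕ n) ⟩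
      fromℕ m - fromℕ n + fromℕ n   ≡⟨ cong (_+ fromℕ n) e ⟩
      0# + fromℕ n                  ≡⟨ +-identityˡ _ ⟩
      fromℕ n                       ∎))
    factors≢0 : two * (fromℕ m - fromℕ n) * (fromℕ m * fromℕ n + ‖ a ‖²) ≢ 0#
    factors≢0 = *-≢0 (*-≢0 two≢0 difference≢0)
      (λ e → positive+nonneg≢0 (0≤‖‖² a) (‖‖²≢0 a≢0) (*-nonneg (0≤fromℕ m) (0≤fromℕ n)) (trans (+-comm _ _) e))

  record Similarity : Set where
    field
      map     : Vector → Vector
      ratio   : Carrier
      ratio≢0 : ratio ≢ 0#
      map-∙   : ∀ x y → map x ∙ map y ≡ ratio * (x ∙ y)

    preserves-⊥ : ∀ {x y} → x ∙ y ≡ 0# → map x ∙ map y ≡ 0#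
    preserves-⊥ {x} {y} x⊥y = trans (map-∙ x y) (trans (cong (ratio *_) x⊥y) (zeroʳ ratio))

    preserves-≢0 : ∀ {x} → x ≢ 0ᵥ → map x ≢ 0ᵥ
    preserves-≢0 {x} x≢0 mx≡0 = *-≢0 ratio≢0 (‖‖²≢0 x≢0) (trans (sym (map-∙ x x)) (trans (cong ‖_‖² mx≡0) (0ᵥ-∙ 0ᵥ)))

    map-× : ∀ x y → ‖ map x ×ᵥ map y ‖² ≡ (ratio * ratio) * ‖ x ×ᵥ y ‖²
    map-× x y = begin
      ‖ map x ×ᵥ map y ‖²                                          ≡⟨ lagrange (map x) (map y) ⟩
      ‖ map x ‖² * ‖ map y ‖² - (map x ∙ map y) * (map x ∙ map y)  ≡⟨ cong₂ (λ p q → p - q * q) (cong₂ _*_ (map-∙ x x) (map-∙ y y)) (map-∙ x y) ⟩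
      (ratio * ‖ x ‖²) * (ratio * ‖ y ‖²) - (ratio * (x ∙ y)) * (ratio * (x ∙ y))
        ≡⟨ solve 4 (λ r p q d → (r :* p) :* (r :* q) :- (r :* d) :* (r :* d) := (r :* r) :* (p :* q :- d :* d))
             refl ratio ‖ x ‖² ‖ y ‖² (x ∙ y) ⟩
      (ratio * ratio) * (‖ x ‖² * ‖ y ‖² - (x ∙ y) * (x ∙ y))      ≡⟨ cong ((ratio * ratio) *_) (sym (lagrange x y)) ⟩
      (ratio * ratio) * ‖ x ×ᵥ y ‖²                                ∎
      where open ≡-Reasoning

    reflects-∥ : ∀ {x y} → Parallel (map x) (map y) → Parallel x y
    reflects-∥ {x} {y} mx∥my = *-cancelˡ-0 (*-≢0 ratio≢0 ratio≢0) (trans (sym (map-× x y)) mx∥my)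

  open Similarity public

  rotation-scalar≢0 : ∀ w {u} → u ≢ 0ᵥ → w * w + ‖ u ‖² ≢ 0#
  rotation-scalar≢0 w {u} u≢0 e = positive+nonneg≢0 (0≤‖‖² u) (‖‖²≢0 u≢0) (0≤square w) (trans (+-comm _ _) e)

  rotation-similarity : ∀ w u → u ≢ 0ᵥ → Similarity
  rotation-similarity w u u≢0 = record
    { map = rotation w u ; ratio = q * q ; ratio≢0 = *-≢0 q≢0 q≢0 ; map-∙ = rotation-∙ w u }
    where
    q : Carrier
    q = w * w + ‖ u ‖²
    q≢0 : q ≢ 0#
    q≢0 = rotation-scalar≢0 w u≢0

  _∘ₛ_ : Similarity → Similarity → Similarity
  S ∘ₛ T = record
    { map = λ x → map S (map T x) ; ratio = ratio S * ratio T ; ratio≢0 = *-≢0 (ratio≢0 S) (ratio≢0 T)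
    ; map-∙ = λ x y → trans (map-∙ S _ _) (trans (cong (ratio S *_) (map-∙ T x y)) (sym (*-assoc _ _ _))) }

module TwistingSimilarity (ℝ : RealNumbers) {n : ℕ} (f : Fin n → Vec3 ℝ)
  (f≢0 : ∀ i → NonZero3 ℝ (f i)) (f-injective : ∀ i j → SameLine ℝ (f i) (f j) → i ≡ j) (v : Fin n) where
  open Space ℝ

  a : Vector
  a = f v

  a≢0 : a ≢ 0ᵥ
  a≢0 = f≢0 v

  α : Carrier
  α = ‖ a ‖²

  turn : ∀ {m} → Fin m → Similarity
  turn k = rotation-similarity (fromℕ (F.toℕ k)) a a≢0

  turns-separate : ∀ {m} (k l : Fin m) x → k F.< l → Parallel (map (turn k) x) (map (turn l) x) → Parallel a x
  turns-separate k l x k<l = rotations-separate x a≢0 k<l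

  c : Vector
  c = proj₁ (orthogonal-vector a≢0)

  a⊥c : a ∙ c ≡ 0#
  a⊥c = proj₁ (proj₂ (orthogonal-vector a≢0))

  c≢0 : c ≢ 0ᵥ
  c≢0 = proj₂ (proj₂ (orthogonal-vector a≢0))

  a∦c : ¬ Parallel a c
  a∦c a∥c = *-≢0 (‖‖²≢0 a≢0) (‖‖²≢0 c≢0)
    (trans (solve 2 (λ p q → p :* q := p :* q :- con +[ 0 ] :* con +[ 0 ]) refl α ‖ c ‖²)
      (trans (cong (λ d → α * ‖ c ‖² - d * d) (sym a⊥c)) (trans (sym (lagrange a c)) a∥c)))

  first-choice : Σ (Fin (suc n)) λ k → ∀ j → ‖ map (turn k) c ×ᵥ f j ‖² ≢ 0#
  first-choice = avoid n (λ k j → ‖ map (turn k) c ×ᵥ f j ‖²) (λ k j → 0≤‖‖² _)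
    (λ k l j k<l kc∥fj lc∥fj → a∦c (turns-separate k l c k<l (parallel-trans (f≢0 j) kc∥fj (parallel-sym lc∥fj))))

  -- b is still orthogonal to a, since rotations about a preserve a⊥
  b : Vector
  b = map (turn (proj₁ first-choice)) c

  a⊥b : a ∙ b ≡ 0#
  a⊥b = trans (axis-∙-rotation _ a c) (*-vanishes _ a⊥c)

  b₀-scale : Σ Carrier λ s → s ≢ 0# × ‖ s ·ᵥ b ‖² ≡ α
  b₀-scale = rescale α (0≤‖‖² a) (‖‖²≢0 a≢0) (preserves-≢0 (turn (proj₁ first-choice)) c≢0)

  b₀ : Vector
  b₀ = proj₁ b₀-scale ·ᵥ b

  a⊥b₀ : a ∙ b₀ ≡ 0#
  a⊥b₀ = trans (∙-scaleʳ _ a b) (*-vanishes _ a⊥b)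

  b₀∦f : ∀ j → ¬ Parallel b₀ (f j)
  b₀∦f j b₀∥fj = proj₂ first-choice j (*-cancelˡ-0 (*-≢0 s≢0 s≢0) (trans (sym (×-scaleˡ _ b (f j))) b₀∥fj))
    where
    s≢0 : proj₁ b₀-scale ≢ 0#
    s≢0 = proj₁ (proj₂ b₀-scale)

  a+b₀≢0 : a ⊕ᵥ b₀ ≢ 0ᵥ
  a+b₀≢0 a+b₀≡0 = ‖‖²≢0 a≢0 (begin
    α                   ≡⟨ sym (+-identityʳ α) ⟩
    α + 0#              ≡⟨ cong (α +_) (sym a⊥b₀) ⟩
    α + a ∙ b₀          ≡⟨ sym (∙-⊕ a a b₀) ⟩
    a ∙ (a ⊕ᵥ b₀)       ≡⟨ cong (a ∙_) a+b₀≡0 ⟩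
    a ∙ 0ᵥ              ≡⟨ trans (∙-comm a 0ᵥ) (0ᵥ-∙ a) ⟩
    0#                  ∎)
    where open ≡-Reasoning

  H : Similarity
  H = rotation-similarity 0# (a ⊕ᵥ b₀) a+b₀≢0

  H-a : map H a ≡ (two * α) ·ᵥ b₀
  H-a = half-turn a b₀ a⊥b₀ (proj₂ (proj₂ b₀-scale))

  candidate : ∀ {m} → Fin m → Similarity
  candidate k = H ∘ₛ turn k

  κ : ∀ {m} → Fin m → Carrier
  κ k = (fromℕ (F.toℕ k) * fromℕ (F.toℕ k) + α) * (two * α)

  κ≢0 : ∀ {m} (k : Fin m) → κ k ≢ 0#
  κ≢0 k = *-≢0 (rotation-scalar≢0 _ a≢0) (*-≢0 two≢0 (‖‖²≢0 a≢0))

  candidate-a : ∀ {m} (k : Fin m) → map (candidate k) a ≡ κ k ·ᵥ b₀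
  candidate-a k = begin
    map H (rotation w a a)        ≡⟨ cong (map H) (rotation-axis w a) ⟩
    map H ((w * w + α) ·ᵥ a)      ≡⟨ rotation-scale 0# (a ⊕ᵥ b₀) _ a ⟩
    (w * w + α) ·ᵥ map H a        ≡⟨ cong ((w * w + α) ·ᵥ_) H-a ⟩
    (w * w + α) ·ᵥ ((two * α) ·ᵥ b₀) ≡⟨ ·ᵥ-assoc _ _ b₀ ⟩
    κ k ·ᵥ b₀                     ∎
    where
    open ≡-Reasoning
    w : Carrier
    w = fromℕ (F.toℕ k)

  candidate-a∦f : ∀ {m} (k : Fin m) j → ¬ Parallel (map (candidate k) a) (f j)
  candidate-a∦f k j ka∥fj = b₀∦f j (*-cancelˡ-0 (*-≢0 (κ≢0 k) (κ≢0 k))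
    (trans (sym (×-scaleˡ (κ k) b₀ (f j))) (subst (λ x → Parallel x (f j)) (candidate-a k) ka∥fj)))

  -- constraint p forbids R (f i) ∥ f j for the pair (i , j) encoded by p
  pair : Fin (n ℕ.* n) → Fin n × Fin n
  pair = F.remQuot n

  second-choice : Σ (Fin (suc (n ℕ.* n))) λ k → ∀ p → ‖ map (candidate k) (f (proj₁ (pair p))) ×ᵥ f (proj₂ (pair p)) ‖² ≢ 0#
  second-choice = avoid (n ℕ.* n) (λ k p → ‖ map (candidate k) (f (proj₁ (pair p))) ×ᵥ f (proj₂ (pair p)) ‖²) (λ k p → 0≤‖‖² _) unique
    where
    unique : ∀ k l p → k F.< l → Parallel (map (candidate k) (f (proj₁ (pair p)))) (f (proj₂ (pair p))) →
             Parallel (map (candidate l) (f (proj₁ (pair p)))) (f (proj₂ (pair p))) → ⊥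
    unique k l p k<l kfi∥fj lfi∥fj = candidate-a∦f k j (subst (λ i′ → Parallel (map (candidate k) (f i′)) (f j)) i≡v kfi∥fj)
      where
      i j : Fin n
      i = proj₁ (pair p)
      j = proj₂ (pair p)
      a∥fi : Parallel a (f i)
      a∥fi = turns-separate k l (f i) k<l (reflects-∥ H (parallel-trans (f≢0 j) kfi∥fj (parallel-sym lfi∥fj)))
      i≡v : i ≡ v
      i≡v = f-injective i v (parallel⇒multiple a≢0 a∥fi)

  R : Similarity
  R = candidate (proj₁ second-choice)

  R-a⊥a : a ∙ map R a ≡ 0#
  R-a⊥a = trans (cong (a ∙_) (candidate-a (proj₁ second-choice))) (trans (∙-scaleʳ _ a b₀) (*-vanishes _ a⊥b₀))

  R-avoids : ∀ i j → ¬ Parallel (map R (f i)) (f j)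
  R-avoids i j Rfi∥fj = proj₂ second-choice (F.combine i j)
    (subst (λ q → Parallel (map R (f (proj₁ q))) (f (proj₂ q))) (sym (FP.remQuot-combine i j)) Rfi∥fj)

-- The twin of a graph G at a vertex v: two disjoint copies of G whose two
-- copies of v are joined by an edge.  Vertex i of copy c ∈ Fin 2 is the
-- vertex  combine c i  of Fin (2 * n).
module Twin {n : ℕ} (G : Graph n) (v : Fin n) where

  is-v : Fin n → Bool
  is-v i = does (i F.≟ v)

  is-v⇒≡ : ∀ {i} → is-v i ≡ true → i ≡ v
  is-v⇒≡ {i} e with i F.≟ v
  is-v⇒≡ {i} e  | yes i≡v = i≡v
  is-v⇒≡ {i} () | no _

  is-v-v : is-v v ≡ true
  is-v-v with v F.≟ v
  ... | yes _   = refl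
  ... | no v≢v = ⊥-elim (v≢v refl)

  bridge : Fin n → Fin n → Bool
  bridge i j = is-v i ∧ is-v j

  bridge⇒v : ∀ {i j} → bridge i j ≡ true → i ≡ v × j ≡ v
  bridge⇒v {i} {j} e with is-v i in eq-i | is-v j in eq-j
  ... | true | true = is-v⇒≡ eq-i , is-v⇒≡ eq-j
  bridge⇒v {i} {j} () | true | false
  bridge⇒v {i} {j} () | false | _

  twin-adj : Fin 2 × Fin n → Fin 2 × Fin n → Bool
  twin-adj (zero     , i) (zero     , j) = adj G i j
  twin-adj (suc zero , i) (suc zero , j) = adj G i j
  twin-adj (zero     , i) (suc zero , j) = bridge i j
  twin-adj (suc zero , i) (zero     , j) = bridge i j

  twin-adj-sym : ∀ p q → twin-adj p q ≡ twin-adj q p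
  twin-adj-sym (zero     , i) (zero     , j) = adj-sym G i j
  twin-adj-sym (suc zero , i) (suc zero , j) = adj-sym G i j
  twin-adj-sym (zero     , i) (suc zero , j) = BoolP.∧-comm (is-v i) (is-v j)
  twin-adj-sym (suc zero , i) (zero     , j) = BoolP.∧-comm (is-v i) (is-v j)

  twin-adj-irrefl : ∀ p → twin-adj p p ≡ false
  twin-adj-irrefl (zero     , i) = adj-irrefl G i
  twin-adj-irrefl (suc zero , i) = adj-irrefl G i

  twin-adj-same : ∀ c i j → twin-adj (c , i) (c , j) ≡ adj G i j
  twin-adj-same zero       i j = refl
  twin-adj-same (suc zero) i j = refl

  twin : Graph (2 ℕ.* n)
  twin = record
    { adj        = λ x y → twin-adj (F.remQuot n x) (F.remQuot n y)
    ; adj-sym    = λ x y → twin-adj-sym (F.remQuot n x) (F.remQuot n y)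
    ; adj-irrefl = λ x → twin-adj-irrefl (F.remQuot n x) }

  copy : Fin 2 → Fin n → Fin (2 ℕ.* n)
  copy = F.combine

  remQuot-injective : ∀ {x y : Fin (2 ℕ.* n)} → F.remQuot {2} n x ≡ F.remQuot {2} n y → x ≡ y
  remQuot-injective {x} {y} e = begin
    x                                              ≡⟨ sym (FP.combine-remQuot {2} n x) ⟩
    F.combine (proj₁ (F.remQuot n x)) (proj₂ (F.remQuot n x)) ≡⟨ cong (λ p → F.combine (proj₁ p) (proj₂ p)) e ⟩
    F.combine (proj₁ (F.remQuot n y)) (proj₂ (F.remQuot n y)) ≡⟨ FP.combine-remQuot {2} n y ⟩
    y                                              ∎
    where open ≡-Reasoning

  adj-copy : ∀ c d i j → adj twin (copy c i) (copy d j) ≡ twin-adj (c , i) (d , j)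
  adj-copy c d i j = cong₂ twin-adj (FP.remQuot-combine c i) (FP.remQuot-combine d j)

  restrict : ∀ (colour : Fin (2 ℕ.* n) → Bool) c → Is010Coloring twin colour → Is010Coloring G (λ i → colour (copy c i))
  restrict colour c (triangles , edges) =
      (λ i j k ij jk ik → triangles _ _ _ (lift i j ij) (lift j k jk) (lift i k ik))
    , (λ i j ij → edges _ _ (lift i j ij))
    where
    lift : ∀ i j → adj G i j ≡ true → adj twin (copy c i) (copy c j) ≡ true
    lift i j ij = trans (adj-copy c c i j) (trans (twin-adj-same c i j) ij)

  twin-not-colorable : HasFixedColor G v true → ¬ Colorable010 twin
  twin-not-colorable (_ , fixed) (colour , coloring) =
    proj₂ coloring (copy zero v) (copy (suc zero) v) bridged
      (fixed _ (restrict colour zero coloring) , fixed _ (restrict colour (suc zero) coloring))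
    where
    bridged : adj twin (copy zero v) (copy (suc zero) v) ≡ true
    bridged = trans (adj-copy zero (suc zero) v v) (cong₂ _∧_ is-v-v is-v-v)

module TwinEmbedding (ℝ : RealNumbers) {n : ℕ} (G : Graph n) (v : Fin n) (embedding : Embeddable ℝ G) where
  open Space ℝ
  open Twin G v

  f : Fin n → Vector
  f = proj₁ embedding

  f≢0 : ∀ i → f i ≢ 0ᵥ
  f≢0 = proj₁ (proj₂ embedding)

  f-injective : ∀ i j → SameLine ℝ (f i) (f j) → i ≡ j
  f-injective = proj₁ (proj₂ (proj₂ embedding))

  f-orthogonal : ∀ i j → adj G i j ≡ true → f i ∙ f j ≡ 0#
  f-orthogonal = proj₂ (proj₂ (proj₂ embedding))

  module _ (R : Similarity) (twisted : f v ∙ map R (f v) ≡ 0#) (avoids : ∀ i j → ¬ Parallel (map R (f i)) (f j)) where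

    place : Fin 2 × Fin n → Vector
    place (zero     , i) = f i
    place (suc zero , i) = map R (f i)

    place≢0 : ∀ p → place p ≢ 0ᵥ
    place≢0 (zero     , i) = f≢0 i
    place≢0 (suc zero , i) = preserves-≢0 R (f≢0 i)

    place-injective : ∀ p q → SameLine ℝ (place p) (place q) → p ≡ q
    place-injective (zero     , i) (zero     , j) same = cong (zero ,_) (f-injective i j same)
    place-injective (suc zero , i) (suc zero , j) same =
      cong (suc zero ,_) (f-injective i j (parallel⇒multiple (f≢0 j) (parallel-sym (reflects-∥ R (sameLine⇒parallel same)))))
    place-injective (zero     , i) (suc zero , j) same = ⊥-elim (avoids j i (parallel-sym (sameLine⇒parallel same)))
    place-injective (suc zero , i) (zero     , j) same = ⊥-elim (avoids i j (sameLine⇒parallel same))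

    place-orthogonal : ∀ p q → twin-adj p q ≡ true → place p ∙ place q ≡ 0#
    place-orthogonal (zero     , i) (zero     , j) ij = f-orthogonal i j ij
    place-orthogonal (suc zero , i) (suc zero , j) ij = preserves-⊥ R (f-orthogonal i j ij)
    place-orthogonal (zero     , i) (suc zero , j) ij with bridge⇒v {i} {j} ij
    ... | refl , refl = twisted
    place-orthogonal (suc zero , i) (zero     , j) ij with bridge⇒v {i} {j} ij
    ... | refl , refl = trans (∙-comm _ _) twisted

    twin-embeddable : Embeddable ℝ twin
    twin-embeddable =
        (λ x → place (F.remQuot {2} n x))
      , (λ x → place≢0 (F.remQuot {2} n x))
      , (λ x y same → remQuot-injective (place-injective (F.remQuot {2} n x) (F.remQuot {2} n y) same))
      , (λ x y xy → place-orthogonal (F.remQuot {2} n x) (F.remQuot {2} n y) xy)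

open import Data.Nat using (_*_)

mainTheorem2 : (ℝ : RealNumbers) (n : ℕ) (G : Graph n) →
    Embeddable ℝ G → (∃ λ v → HasFixedColor G v true) →
    Σ (Graph (2 * n)) (λ H → KochenSpecker ℝ H)
mainTheorem2 ℝ n G embedding (v , fixed) =
  twin , twin-embeddable R R-a⊥a R-avoids , twin-not-colorable fixed
  where
  open Twin G v
  open TwinEmbedding ℝ G v embedding
  open TwistingSimilarity ℝ f f≢0 f-injective v using (R; R-a⊥a; R-avoids)
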